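{- Let $\kappa$ be an infinite cardinal, $\mathscr{D}$ a countably incomplete ultrafilter over $\kappa$, and $\mathcal{L}$ a finite relational signature. Let $\mathcal{K}$ be the age of an infinite $\mathcal{L}$-structure, with its countably many isomorphism types enumerated as $(\mathcal{A}_n)_{n\in\omega}$ such that $\mathcal{A}_n\in\mathcal{K}$, $\mathcal{A}_n$ embeds into $\mathcal{A}_{n+1}$ for all $n$, and every $\mathcal{A}\in\mathcal{K}$ embeds into some $\mathcal{A}_n$. Let $(X_n)_{n\in\omega}$ be sets with $X_n\in\mathscr{D}$ for all $n$ and $\bigcap_nX_n=\emptyset$, and put $\overline{X}_n:=\kappa\setminus X_n$. For $t\in\kappa$ define $\mathcal{B}_t:=\mathcal{A}_n$ if and only if $t\in\overline{X}_n\setminus\bigcup_{m<n}\overline{X}_m$. Then the sequence $(\mathcal{B}_t)_{t\in\kappa}$ is well defined (every $t\in\kappa$ lies in exactly one such set), and, with $\mathfrak{M}^*:=\prod_{t\in\kappa}\mathcal{B}_t/\mathscr{D}$, \[ \mathrm{age}(\mathfrak{M}^*)=\mathcal{K}=\bigcup\{\mathrm{age}(\mathcal{B}_t):t\in\kappa\}. \]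
   Context: The age of an $\mathcal{L}$-structure is the class of finite $\mathcal{L}$-structures embeddable into it; equalities of ages are up to isomorphism (classes closed under isomorphism). -}

module Defs where

open import Level using (0ℓ)
open import Data.Nat using (ℕ; suc; _<_)
open import Data.Fin using (Fin)
open import Data.Vec using (Vec; []; _∷_; map)
open import Data.Vec.Relation.Binary.Pointwise.Inductive as PW using (Pointwise; []; _∷_; Pointwise-≡⇒≡)
open import Data.Product using (Σ; ∃; _×_; _,_; proj₁; proj₂)
open import Data.Sum using (_⊎_)
open import Data.Unit using (⊤; tt)
open import Data.Empty using (⊥)
open import Relation.Nullary using (¬_)
open import Relation.Unary using (Pred; _⊆_; _∩_; ∁; ∅; U)
open import Relation.Binary using (Rel; IsEquivalence)
open import Relation.Binary.PropositionalEquality using (_≡_; refl; subst) renaming (isEquivalence to ≡-isEquivalence)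

record Signature : Set where
  field
    nRel  : ℕ
    arity : Fin nRel → ℕ
open Signature public

-- L-structures.  The carrier comes with an equality (a setoid), which is
-- needed to form ultraproducts without quotient types; relations respect it.
-- For ordinary structures the equality is _≡_.

record Structure (L : Signature) : Set₁ where
  field
    Carrier       : Set
    _≈_           : Rel Carrier 0ℓ
    isEquivalence : IsEquivalence _≈_
    rel           : (i : Fin (nRel L)) → Vec Carrier (arity L i) → Set
    rel-resp      : ∀ i {xs ys} → Pointwise _≈_ xs ys → rel i xs → rel i ys
open Structure public

record Embedding {L : Signature} (A B : Structure L) : Set where
  field
    fun     : Carrier A → Carrier B
    cong    : ∀ {x y} → _≈_ A x y → _≈_ B (fun x) (fun y)
    inj     : ∀ {x y} → _≈_ B (fun x) (fun y) → _≈_ A x y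
    preserve : ∀ i xs → rel A i xs → rel B i (map fun xs)
    reflect  : ∀ i xs → rel B i (map fun xs) → rel A i xs

Infinite : {L : Signature} → Structure L → Set
Infinite M = ¬ (Σ ℕ λ n → Σ (Fin n → Carrier M) λ g → ∀ x → ∃ λ i → _≈_ M (g i) x)

InfiniteType : Set → Set
InfiniteType κ = ¬ (Σ ℕ λ n → Σ (Fin n → κ) λ g → ∀ x → ∃ λ i → g i ≡ x)

-- Finite structures (nonempty, as structures are by convention):
-- carrier Fin (suc n) with equality _≡_.  Every finite structure is
-- isomorphic to one of these, so classes of them are classes up to iso.

record FinStr (L : Signature) : Set₁ where
  field
    size : ℕ
    frel : (i : Fin (nRel L)) → Vec (Fin (suc size)) (arity L i) → Set
open FinStr public

⟦_⟧ : {L : Signature} → FinStr L → Structure L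
⟦ A ⟧ = record
  { Carrier = Fin (suc (size A))
  ; _≈_ = _≡_
  ; isEquivalence = ≡-isEquivalence
  ; rel = frel A
  ; rel-resp = λ i p r → subst (frel A i) (Pointwise-≡⇒≡ p) r
  }

Age : {L : Signature} → Structure L → FinStr L → Set
Age M A = Embedding ⟦ A ⟧ M

record Ultrafilter (κ : Set) : Set₁ where
  field
    member  : Pred κ 0ℓ → Set
    full    : member U
    proper  : ¬ member ∅
    upward  : ∀ {X Y} → X ⊆ Y → member X → member Y
    inter   : ∀ {X Y} → member X → member Y → member (X ∩ Y)
    ultra   : ∀ X → member X ⊎ member (∁ X)
open Ultrafilter public

CountablyIncomplete : {κ : Set} → Ultrafilter κ → Set₁
CountablyIncomplete {κ} D =
  Σ (ℕ → Pred κ 0ℓ) λ X → (∀ n → member D (X n)) × (∀ t → ¬ (∀ n → X n t))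

module _ {L : Signature} {κ : Set} (D : Ultrafilter κ) (B : κ → Structure L) where

  private
    _∈D : Pred κ 0ℓ → Set
    X ∈D = member D X
    Elt = (t : κ) → Carrier (B t)
    _~_ : Rel Elt 0ℓ
    f ~ g = (λ t → _≈_ (B t) (f t) (g t)) ∈D

    at : ∀ {m} → Vec Elt m → (t : κ) → Vec (Carrier (B t)) m
    at xs t = map (λ f → f t) xs

    ~-equiv : IsEquivalence _~_
    ~-equiv = record
      { refl  = upward D (λ {t} _ → IsEquivalence.refl (isEquivalence (B t))) (full D)
      ; sym   = λ p → upward D (λ {t} q → IsEquivalence.sym (isEquivalence (B t)) q) p
      ; trans = λ p q → upward D (λ {t} r → IsEquivalence.trans (isEquivalence (B t)) (proj₁ r) (proj₂ r)) (inter D p q)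
      }

    pw : ∀ {m} {xs ys : Vec Elt m} → Pointwise _~_ xs ys →
         (λ t → Pointwise (_≈_ (B t)) (at xs t) (at ys t)) ∈D
    pw [] = upward D (λ _ → []) (full D)
    pw (p ∷ ps) = upward D (λ r → proj₁ r ∷ proj₂ r) (inter D p (pw ps))

  Ultraproduct : Structure L
  Ultraproduct = record
    { Carrier = Elt
    ; _≈_ = _~_
    ; isEquivalence = ~-equiv
    ; rel = λ i xs → (λ t → rel (B t) i (at xs t)) ∈D
    ; rel-resp = λ i p r → upward D (λ {t} q → rel-resp (B t) i (proj₁ q) (proj₂ q)) (inter D (pw p) r)
    }

Slot : {κ : Set} → (ℕ → Pred κ 0ℓ) → ℕ → κ → Set
Slot X n t = ∁ (X n) t × ¬ (∃ λ m → m < n × ∁ (X m) t)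

-- A finite substructure of an ultraproduct is determined by finitely many
-- atomic facts, each holding on a D-large set; intersecting these sets and
-- picking a point gives Łoś's theorem for it: it embeds into some factor Bₜ.
-- Every factor A (ν t) lies in the age of M, so age 𝔐* ⊆ age M.  Conversely,
-- each Xₙ ∈ D forces ν t ≥ n on a D-large set, where the chain A n ↪ A (ν t)
-- applies; gluing these embeddings coordinatewise embeds A n into 𝔐*.
module Submission where

open import Defs
open import Level using (0ℓ)
open import Axiom.ExcludedMiddle using (ExcludedMiddle)
open import Data.Nat using (ℕ; suc; zero; _≤_; _<_; _≤′_; ≤′-refl; ≤′-step)
open import Data.Nat.Properties using (≤⇒≤′; ≮⇒≥; <-cmp)
open import Data.Nat.Induction using (<-rec)
open import Data.Fin using (Fin; toℕ; fromℕ<) renaming (zero to fzero; suc to fsuc; _≟_ to _≟ᶠ_)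
open import Data.Fin.Properties using (toℕ-fromℕ<)
open import Data.Vec using (Vec; []; _∷_; map)
open import Data.Vec.Properties using (map-∘; map-cong; map-id)
open import Data.Product using (Σ; ∃; ∃!; _×_; _,_; proj₁; proj₂)
open import Data.Sum using (inj₁; inj₂)
open import Data.Empty using (⊥-elim)
open import Relation.Nullary using (¬_; yes; no)
open import Relation.Unary using (Pred)
open import Relation.Binary using (IsEquivalence; tri<; tri≈; tri>)
open import Relation.Binary.PropositionalEquality using (_≡_; refl; sym; trans; subst)
open import Function.Bundles using (_⇔_; mk⇔; Equivalence)

module _ {L : Signature} where

  embedding-refl : {A : Structure L} → Embedding A A
  embedding-refl {A} = record
    { fun      = λ x → x
    ; cong     = λ p → p
    ; inj      = λ p → p
    ; preserve = λ i xs → subst (rel A i) (sym (map-id xs))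
    ; reflect  = λ i xs → subst (rel A i) (map-id xs)
    }

  embedding-trans : {A B C : Structure L} → Embedding A B → Embedding B C → Embedding A C
  embedding-trans {C = C} f g = record
    { fun      = λ x → G (F x)
    ; cong     = λ p → Embedding.cong g (Embedding.cong f p)
    ; inj      = λ p → Embedding.inj f (Embedding.inj g p)
    ; preserve = λ i xs r → subst (rel C i) (sym (map-∘ G F xs))
                   (Embedding.preserve g i _ (Embedding.preserve f i xs r))
    ; reflect  = λ i xs r → Embedding.reflect f i xs
                   (Embedding.reflect g i _ (subst (rel C i) (map-∘ G F xs) r))
    }
    where
    F = Embedding.fun f
    G = Embedding.fun g

  chain-embedding : (A : ℕ → Structure L) → (∀ n → Embedding (A n) (A (suc n))) →
                    ∀ {n m} → n ≤ m → Embedding (A n) (A m)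
  chain-embedding A step n≤m = go (≤⇒≤′ n≤m)
    where
    go : ∀ {n m} → n ≤′ m → Embedding (A n) (A m)
    go ≤′-refl      = embedding-refl
    go (≤′-step p)  = embedding-trans (go p) (step _)

module _ {κ : Set} (D : Ultrafilter κ) where

  member-∀Fin : ∀ n {P : Fin n → Pred κ 0ℓ} → (∀ i → member D (P i)) →
                member D (λ t → ∀ i → P i t)
  member-∀Fin zero    h = upward D (λ _ ()) (full D)
  member-∀Fin (suc n) h =
    upward D (λ { (p₀ , p) → λ { fzero → p₀ ; (fsuc i) → p i } })
      (inter D (h fzero) (member-∀Fin n (λ i → h (fsuc i))))

  member-∀Vec : ∀ m k {P : Vec (Fin k) m → Pred κ 0ℓ} → (∀ xs → member D (P xs)) →
                member D (λ t → ∀ xs → P xs t)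
  member-∀Vec zero    k h = upward D (λ { p [] → p }) (h [])
  member-∀Vec (suc m) k h =
    upward D (λ p → λ { (x ∷ xs) → p x xs })
      (member-∀Fin k (λ x → member-∀Vec m k (λ xs → h (x ∷ xs))))

  slot-unique : {X : ℕ → Pred κ 0ℓ} {a b : ℕ} {t : κ} → Slot X a t → Slot X b t → a ≡ b
  slot-unique {a = a} {b} (∉Xa , minA) (∉Xb , minB) with <-cmp a b
  ... | tri< a<b _ _ = ⊥-elim (minB (a , a<b , ∉Xa))
  ... | tri≈ _ a≡b _ = a≡b
  ... | tri> _ _ b<a = ⊥-elim (minA (b , b<a , ∉Xb))

  slot-eventually-above : {X : ℕ → Pred κ 0ℓ} → (∀ n → member D (X n)) →
                          (ν : κ → ℕ) → (∀ t → Slot X (ν t) t) →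
                          ∀ n → member D (λ t → n ≤ ν t)
  slot-eventually-above {X} X∈D ν slot n =
    upward D (λ {t} x → ≮⇒≥ λ ν<n →
               proj₁ (slot t) (subst (λ m → X m t) (toℕ-fromℕ< ν<n) (x (fromℕ< ν<n))))
      (member-∀Fin n (λ i → X∈D (toℕ i)))

module Classical (lem : ExcludedMiddle 0ℓ) where

  least-witness : (P : ℕ → Set) → ∃ P → ∃ λ n → P n × ¬ (∃ λ m → m < n × P m)
  least-witness P (n , p) = <-rec Goal search n p
    where
    Goal : ℕ → Set
    Goal n = P n → ∃ λ n → P n × ¬ (∃ λ m → m < n × P m)
    search : ∀ n → (∀ {m} → m < n → Goal m) → Goal n
    search n below p with lem {∃ λ m → m < n × P m}
    ... | yes (m , m<n , q) = below m<n q
    ... | no  none          = n , p , none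

  slot-exists : {κ : Set} (X : ℕ → Pred κ 0ℓ) (t : κ) → ¬ (∀ n → X n t) → ∃ λ n → Slot X n t
  slot-exists X t notAll = least-witness (λ n → ¬ X n t) outside
    where
    outside : ∃ λ n → ¬ X n t
    outside with lem {∃ λ n → ¬ X n t}
    ... | yes w = w
    ... | no ¬w = ⊥-elim (notAll inside)
      where
      inside : ∀ n → X n t
      inside n with lem {X n t}
      ... | yes x = x
      ... | no ¬x = ⊥-elim (¬w (n , ¬x))

  module _ {κ : Set} (D : Ultrafilter κ) where

    member⇒nonempty : {Y : Pred κ 0ℓ} → member D Y → ∃ Y
    member⇒nonempty {Y} Y∈D with lem {∃ Y}
    ... | yes w = w
    ... | no ¬w = ⊥-elim (proper D (upward D (λ {t} y → ¬w (t , y)) Y∈D))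

    ultraproduct-age⇒factor-age : {L : Signature} (B : κ → Structure L) (C : FinStr L) →
                                  Age (Ultraproduct D B) C → ∃ λ t → Age (B t) C
    ultraproduct-age⇒factor-age {L} B C e = t , record
      { fun      = λ a → f a t
      ; cong     = λ { refl → IsEquivalence.refl (isEquivalence (B t)) }
      ; inj      = λ {a} {b} → injective a b
      ; preserve = λ i xs r → subst (rel (B t) i) (sym (map-∘ (λ g → g t) f xs)) (Equivalence.to (atomic i xs) r)
      ; reflect  = λ i xs r → Equivalence.from (atomic i xs) (subst (rel (B t) i) (map-∘ (λ g → g t) f xs) r)
      }
      where
      n : ℕ
      n = suc (size C)

      f : Fin n → (t : κ) → Carrier (B t)
      f = Embedding.fun e

      at : (t : κ) → ∀ {m} → Vec (Fin n) m → Vec (Carrier (B t)) m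
      at t xs = map (λ g → g t) (map f xs)

      Injective-at : Pred κ 0ℓ
      Injective-at t = ∀ a b → _≈_ (B t) (f a t) (f b t) → a ≡ b

      Atomic-at : Pred κ 0ℓ
      Atomic-at t = ∀ i xs → frel C i xs ⇔ rel (B t) i (at t xs)

      injective-almost : member D Injective-at
      injective-almost = member-∀Fin D n λ a → member-∀Fin D n λ b → pair a b
        where
        pair : ∀ a b → member D (λ t → _≈_ (B t) (f a t) (f b t) → a ≡ b)
        pair a b with a ≟ᶠ b
        ... | yes a≡b = upward D (λ _ _ → a≡b) (full D)
        ... | no  a≢b with ultra D (λ t → _≈_ (B t) (f a t) (f b t))
        ...   | inj₁ same = ⊥-elim (a≢b (Embedding.inj e same))
        ...   | inj₂ diff = upward D (λ ≉ ≈ → ⊥-elim (≉ ≈)) diff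

      atomic-almost : member D Atomic-at
      atomic-almost = member-∀Fin D (nRel L) λ i → member-∀Vec D (arity L i) n (fact i)
        where
        fact : ∀ i xs → member D (λ t → frel C i xs ⇔ rel (B t) i (at t xs))
        fact i xs with lem {frel C i xs}
        ... | yes r = upward D (λ q → mk⇔ (λ _ → q) (λ _ → r)) (Embedding.preserve e i xs r)
        ... | no ¬r with ultra D (λ t → rel (B t) i (at t xs))
        ...   | inj₁ holds = ⊥-elim (¬r (Embedding.reflect e i xs holds))
        ...   | inj₂ fails = upward D (λ ¬q → mk⇔ (λ r → ⊥-elim (¬r r)) (λ q → ⊥-elim (¬q q))) fails

      good : ∃ λ t → Injective-at t × Atomic-at t
      good = member⇒nonempty (inter D injective-almost atomic-almost)

      t : κ
      t = proj₁ good

      injective : Injective-at t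
      injective = proj₁ (proj₂ good)

      atomic : Atomic-at t
      atomic = proj₂ (proj₂ good)

    -- Off Y the coordinate is the junk value fzero; it is irrelevant because Y ∈ D.
    glued-embedding : {L : Signature} (C : Structure L) (B : κ → FinStr L) (Y : Pred κ 0ℓ) →
                      member D Y → (∀ t → Y t → Embedding C ⟦ B t ⟧) →
                      Embedding C (Ultraproduct D (λ t → ⟦ B t ⟧))
    glued-embedding C B Y Y∈D e = record
      { fun      = g
      ; cong     = λ p → upward D (λ {t} _ → g-cong t p) (full D)
      ; inj      = λ {a} {b} ga≈gb → let t , ga≡gb , y = member⇒nonempty (inter D ga≈gb Y∈D)
                                      in inj-at t y ga≡gb
      ; preserve = λ i xs r → upward D (λ {t} y → preserve-at t y i xs r) Y∈D
      ; reflect  = λ i xs q → let t , qt , y = member⇒nonempty (inter D q Y∈D)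
                              in reflect-at t y i xs qt
      }
      where
      g : Carrier C → (t : κ) → Fin (suc (size (B t)))
      g a t with lem {Y t}
      ... | yes y = Embedding.fun (e t y) a
      ... | no  _ = fzero

      g-cong : ∀ t {a b} → _≈_ C a b → g a t ≡ g b t
      g-cong t p with lem {Y t}
      ... | yes y = Embedding.cong (e t y) p
      ... | no  _ = refl

      agrees : ∀ t → Y t → Σ (Y t) λ y → ∀ a → g a t ≡ Embedding.fun (e t y) a
      agrees t y with lem {Y t}
      ... | yes y′ = y′ , λ _ → refl
      ... | no ¬y  = ⊥-elim (¬y y)

      map-agrees : ∀ t → Y t → Σ (Y t) λ y → ∀ {m} (xs : Vec (Carrier C) m) →
                   map (λ h → h t) (map g xs) ≡ map (Embedding.fun (e t y)) xs
      map-agrees t y = let y′ , eq = agrees t y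
                       in y′ , λ xs → trans (sym (map-∘ (λ h → h t) g xs)) (map-cong eq xs)

      inj-at : ∀ t → Y t → ∀ {a b} → g a t ≡ g b t → _≈_ C a b
      inj-at t y {a} {b} eq = let y′ , agree = agrees t y
                              in Embedding.inj (e t y′) (trans (sym (agree a)) (trans eq (agree b)))

      preserve-at : ∀ t → Y t → ∀ i xs → rel C i xs → frel (B t) i (map (λ h → h t) (map g xs))
      preserve-at t y i xs r = let y′ , agree = map-agrees t y
                               in subst (frel (B t) i) (sym (agree xs)) (Embedding.preserve (e t y′) i xs r)

      reflect-at : ∀ t → Y t → ∀ i xs → frel (B t) i (map (λ h → h t) (map g xs)) → rel C i xs
      reflect-at t y i xs q = let y′ , agree = map-agrees t y
                              in Embedding.reflect (e t y′) i xs (subst (frel (B t) i) (agree xs) q)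

mainTheorem8 :
  -- ambient classical logic (the paper works in ZFC)
  ExcludedMiddle 0ℓ →
  (κ : Set) → InfiniteType κ →
  (D : Ultrafilter κ) → CountablyIncomplete D →
  (L : Signature) →
  (M : Structure L) → Infinite M →
  (A : ℕ → FinStr L) →
  (∀ n → Age M (A n)) →
  (∀ n → Embedding ⟦ A n ⟧ ⟦ A (suc n) ⟧) →
  (∀ C → Age M C → ∃ λ n → Embedding ⟦ C ⟧ ⟦ A n ⟧) →
  (X : ℕ → Pred κ 0ℓ) →
  (∀ n → member D (X n)) →
  (∀ t → ¬ (∀ n → X n t)) →
  -- well-definedness: each t lies in exactly one X̄ₙ ∖ ⋃_{m<n} X̄ₘ
  (∀ t → ∃! _≡_ λ n → Slot X n t)
  ×
  -- for the resulting assignment t ↦ ν t, with Bₜ = A (ν t):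
  (∀ (ν : κ → ℕ) → (∀ t → Slot X (ν t) t) →
    ∀ C → (Age (Ultraproduct D (λ t → ⟦ A (ν t) ⟧)) C ⇔ Age M C)
        × (Age M C ⇔ (∃ λ t → Age ⟦ A (ν t) ⟧ C)))
mainTheorem8 lem κ _ D _ L M _ A A⊆M step cofinal X X∈D ⋂X≡∅ =
  (λ t → let n , s = slot-exists X t (⋂X≡∅ t) in n , s , slot-unique D {X} s) ,
  λ ν slot C →
    let chain : ∀ {n m} → n ≤ m → Embedding ⟦ A n ⟧ ⟦ A m ⟧
        chain = chain-embedding (λ n → ⟦ A n ⟧) step
        above = slot-eventually-above D X∈D ν slot
    in mk⇔ (λ C⊆𝔐 → let t , C⊆B = ultraproduct-age⇒factor-age D _ C C⊆𝔐
                    in embedding-trans C⊆B (A⊆M (ν t)))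
           (λ C⊆M → let n , C⊆A = cofinal C C⊆M
                    in embedding-trans C⊆A (glued-embedding D _ _ _ (above n) (λ t → chain)))
     , mk⇔ (λ C⊆M → let n , C⊆A = cofinal C C⊆M
                        t , n≤ν = member⇒nonempty D (above n)
                    in t , embedding-trans C⊆A (chain n≤ν))
           (λ (t , C⊆B) → embedding-trans C⊆B (A⊆M (ν t)))
  where open Classical lem
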